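{- For every integer $q\ge 3$ there exists a negative orientable sequence of order $2$ over $\mathbb{Z}_q$ with period $(q^2-q)/2$ if $q$ is odd and $(q^2-q)/2-1$ if $q$ is even (i.e.\ attaining the maximum possible period for such sequences).
   Context: Sequences are periodic with entries in $\mathbb{Z}_q$. For $S=(s_i)$ write $\mathbf{s}_n(i)=(s_i,\ldots,s_{i+n-1})$; for an $n$-tuple $\mathbf{u}=(u_0,\ldots,u_{n-1})$ let $\mathbf{u}^R=(u_{n-1},\ldots,u_0)$ and $-\mathbf{u}=(-u_0,\ldots,-u_{n-1})$. A periodic sequence of period $m$ is an $n$-window sequence if $\mathbf{s}_n(i)=\mathbf{s}_n(j)$ implies $i\equiv j\pmod m$; it is a negative orientable sequence of order $n$ if also $\mathbf{s}_n(i)\neq -\mathbf{s}_n(j)^R$ for all $i,j$. -}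

module Defs where

open import Data.Nat using (ℕ; zero; suc; _+_; _*_; _∸_; _<_; _≤_)
open import Data.Nat.DivMod using (_%_; _/_)
open import Data.Fin using (Fin; toℕ)
open import Data.Product using (_×_)
open import Relation.Binary.PropositionalEquality using (_≡_)
open import Relation.Nullary using (¬_)

IsPeriodicSeq : (q m : ℕ) → (ℕ → ℕ) → Set
IsPeriodicSeq q m s = (1 ≤ m) × (∀ i → s i < q) × (∀ i → s (i + m) ≡ s i)

window : (n : ℕ) → (ℕ → ℕ) → ℕ → Fin n → ℕ
window n s i k = s (i + toℕ k)

rev : (n : ℕ) → (Fin n → ℕ) → Fin n → ℕ
rev n u k = u (Data.Fin.opposite k)

-- negation in Z_q on representatives 0 … q-1
-- (for q ≥ 1, suc (q ∸ 1) = q; the suc form only avoids a NonZero instance)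
negq : (q : ℕ) → ℕ → ℕ
negq q x = (q ∸ x) % suc (q ∸ 1)

negTuple : (q : ℕ) → {n : ℕ} → (Fin n → ℕ) → Fin n → ℕ
negTuple q u k = negq q (u k)

TupleEq : {n : ℕ} → (Fin n → ℕ) → (Fin n → ℕ) → Set
TupleEq u v = ∀ k → u k ≡ v k

IsWindowSeq : (q n m : ℕ) → (ℕ → ℕ) → Set
IsWindowSeq q n m s =
  IsPeriodicSeq q m s ×
  (∀ i j → TupleEq (window n s i) (window n s j) →
     i % suc (m ∸ 1) ≡ j % suc (m ∸ 1))

IsNegOrientable : (q : ℕ) → (n m : ℕ) → (ℕ → ℕ) → Set
IsNegOrientable q n m s =
  IsWindowSeq q n m s ×
  (∀ i j → ¬ TupleEq (window n s i) (negTuple q (rev n (window n s j))))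

maxPeriod : ℕ → ℕ
maxPeriod q with q % 2
... | zero = ((q * q ∸ q) / 2) ∸ 1
... | suc _ = (q * q ∸ q) / 2

{-# OPTIONS --safe #-}
module Submission where

open import Defs
open import Data.Nat using (ℕ; _≤_)
open import Data.Product using (Σ)

open import Data.Empty using (⊥; ⊥-elim)
open import Data.Fin using () renaming (zero to fzero; suc to fsuc)
open import Data.List using (List; []; _∷_; length; downFrom)
open import Data.List.Properties using (length-downFrom)
open import Data.Nat using (zero; suc; _+_; _*_; _∸_; _<_; z≤n; s≤s)
open import Data.Nat.DivMod
open import Data.Nat.Properties
open import Data.Nat.Tactic.RingSolver using (solve-∀)
open import Data.Product using (_×_; _,_)
open import Data.Product.Relation.Binary.Lex.Strict using (×-Lex; ×-transitive; ×-irreflexive)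
open import Data.Sum using (inj₁; inj₂)
open import Level using (0ℓ)
open import Relation.Binary.Core using (Rel)
open import Relation.Binary.Definitions using (Transitive; tri<; tri≈; tri>)
open import Relation.Binary.PropositionalEquality
open import Function using (_∘′_; _$_)
open import Relation.Nullary using (¬_)

-- Call (x, y) good if x + y < q with x, y both nonzero, or if one of them is 0 and twice
-- the other is below q.  Negation-reversal sends a good (x, y) to (q − y, q − x) (reading
-- q − 0 as 0), which is never good, so a closed walk on ℤ_q through pairwise distinct good
-- edges is a negative orientable sequence of order 2 whose period is its number of edges.
-- We write such a walk down: the star 0 2 0 3 0 … at 0; then for a = 1, 2, … the loop a a,
-- the rays a c a for a + 1 < c < q − a and the step up to a + 1; finally the descent to 0.
-- Its edges are distinct because they occur in strictly increasing order of an explicit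
-- key, and there are (q² − q)/2 of them for odd q and (q² − q)/2 − 1 for even q.

-- Positions past the end read as 0; only positions inside the list are used.
infixl 10 _‼_
_‼_ : List ℕ → ℕ → ℕ
[]       ‼ _     = 0
(x ∷ xs) ‼ zero  = x
(x ∷ xs) ‼ suc p = xs ‼ p

negq-zero : ∀ {q} → 0 < q → negq q 0 ≡ 0
negq-zero {suc q} _ = n%n≡0 (suc q)

negq-complement : ∀ {q x} → 0 < x → x < q → negq q x + x ≡ q
negq-complement {suc q} {x} 0<x x<q =
  trans (cong (_+ x) (m<n⇒m%n≡m (∸-monoʳ-< 0<x (<⇒≤ x<q)))) (m∸n+n≡m (<⇒≤ x<q))

cyclic : (ℕ → ℕ) → ℕ → ℕ → ℕ
cyclic w m i = w (i % suc m)

module _ {m : ℕ} {w : ℕ → ℕ} (closed : w (suc m) ≡ w 0) where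

  closed-% : ∀ {p} → p ≤ suc m → w (p % suc m) ≡ w p
  closed-% p≤1+m with m≤n⇒m<n∨m≡n p≤1+m
  ... | inj₁ p<1+m = cong w (m<n⇒m%n≡m p<1+m)
  ... | inj₂ refl  = trans (cong w (n%n≡0 (suc m))) (sym closed)

  cyclic-+1 : ∀ i → cyclic w m (i + 1) ≡ w (suc (i % suc m))
  cyclic-+1 i = trans (cong w [i+1]%N) (closed-% (m%n<n i N))
    where
    N = suc m
    open ≡-Reasoning
    [i+1]%N : (i + 1) % N ≡ suc (i % N) % N
    [i+1]%N = begin
      (i + 1) % N               ≡⟨ %-distribˡ-+ i 1 N ⟩
      (i % N + 1 % N) % N       ≡⟨ cong (λ r → (r + 1 % N) % N) (sym (m%n%n≡m%n i N)) ⟩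
      (i % N % N + 1 % N) % N   ≡⟨ sym (%-distribˡ-+ (i % N) 1 N) ⟩
      (i % N + 1) % N           ≡⟨ cong (_% N) (+-comm (i % N) 1) ⟩
      suc (i % N) % N           ∎

  cyclic-negOrientable :
    ∀ {q} (Edge : ℕ → ℕ → Set) →
    (∀ {x y} → Edge x y → x < q) →
    (∀ {x y} → Edge x y → ¬ Edge (negq q y) (negq q x)) →
    (∀ {p} → p ≤ m → Edge (w p) (w (suc p))) →
    (∀ {p p′} → p ≤ m → p′ ≤ m → w p ≡ w p′ → w (suc p) ≡ w (suc p′) → p ≡ p′) →
    IsNegOrientable q 2 (suc m) (cyclic w m)
  cyclic-negOrientable {q} Edge edge-< negation-free edge edges-injective =
    ((s≤s z≤n , entry-< , periodic) , windows-injective) , no-negated-reversal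
    where
    s = cyclic w m

    position≤m : ∀ i → i % suc m ≤ m
    position≤m i = ≤-pred (m%n<n i (suc m))

    s-+0 : ∀ i → s (i + 0) ≡ s i
    s-+0 i = cong s (+-identityʳ i)

    edge-from : ∀ i → Edge (s i) (s (i + 1))
    edge-from i = subst (Edge (s i)) (sym (cyclic-+1 i)) (edge (position≤m i))

    entry-< : ∀ i → s i < q
    entry-< i = edge-< (edge-from i)

    periodic : ∀ i → s (i + suc m) ≡ s i
    periodic i = cong w ([m+n]%n≡m%n i (suc m))

    windows-injective : ∀ i j → TupleEq (window 2 s i) (window 2 s j) → i % suc m ≡ j % suc m
    windows-injective i j same = edges-injective (position≤m i) (position≤m j)
      (trans (sym (s-+0 i)) (trans (same fzero) (s-+0 j)))
      (trans (sym (cyclic-+1 i)) (trans (same (fsuc fzero)) (cyclic-+1 j)))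

    no-negated-reversal : ∀ i j → ¬ TupleEq (window 2 s i) (negTuple q (rev 2 (window 2 s j)))
    no-negated-reversal i j same = negation-free (edge-from j)
      (subst₂ Edge (trans (sym (s-+0 i)) (same fzero))
                   (trans (same (fsuc fzero)) (cong (negq q) (s-+0 j)))
                   (edge-from i))

module RisingWalks {K : Set} (_≺_ : Rel K 0ℓ) (≺-trans : Transitive _≺_)
                   (≺-irrefl : ∀ {k} → ¬ k ≺ k)
                   (Edge : ℕ → ℕ → Set) (key : ℕ → ℕ → K) where

  data Rising : K → List ℕ → ℕ → Set where
    end  : ∀ {k} x → Rising k (x ∷ []) x
    step : ∀ {k x y ys z} → k ≺ key x y → Edge x y → Rising (key x y) (y ∷ ys) z →
           Rising k (x ∷ y ∷ ys) z

  stepAt : ∀ {k k′ x y ys z} → key x y ≡ k′ → k ≺ k′ → Edge x y →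
           Rising k′ (y ∷ ys) z → Rising k (x ∷ y ∷ ys) z
  stepAt refl = step

  weaken : ∀ {k k′ xs z} → k′ ≺ k → Rising k xs z → Rising k′ xs z
  weaken _    (end x)        = end x
  weaken k′≺k (step k≺ e xs) = step (≺-trans k′≺k k≺) e xs

  keyAt : List ℕ → ℕ → K
  keyAt xs p = key (xs ‼ p) (xs ‼ suc p)

  edgeAt : ∀ {k xs z} → Rising k xs z → ∀ p → suc p < length xs →
           Edge (xs ‼ p) (xs ‼ suc p)
  edgeAt (end _)      _       (s≤s ())
  edgeAt (step _ e _) zero    _        = e
  edgeAt (step _ _ r) (suc p) (s≤s lt) = edgeAt r p lt

  below-keyAt : ∀ {k xs z} → Rising k xs z → ∀ p → suc p < length xs → k ≺ keyAt xs p
  below-keyAt (end _)       _       (s≤s ())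
  below-keyAt (step k≺ _ _) zero    _        = k≺
  below-keyAt (step k≺ _ r) (suc p) (s≤s lt) = ≺-trans k≺ (below-keyAt r p lt)

  keyAt-increasing : ∀ {k xs z} → Rising k xs z → ∀ {p p′} → p < p′ → suc p′ < length xs →
                     keyAt xs p ≺ keyAt xs p′
  keyAt-increasing (end _)      _ (s≤s ())
  keyAt-increasing (step _ _ r) {zero}  {suc p′} _          (s≤s lt) = below-keyAt r p′ lt
  keyAt-increasing (step _ _ r) {suc p} {suc p′} (s≤s p<p′) (s≤s lt) =
    keyAt-increasing r p<p′ lt

  keyAt-injective : ∀ {k xs z} → Rising k xs z → ∀ {p p′} →
                    suc p < length xs → suc p′ < length xs →
                    keyAt xs p ≡ keyAt xs p′ → p ≡ p′
  keyAt-injective {xs = xs} r {p} {p′} lt lt′ same with <-cmp p p′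
  ... | tri≈ _ p≡p′ _ = p≡p′
  ... | tri< p<p′ _ _ =
    ⊥-elim (≺-irrefl (subst (_≺ keyAt xs p′) same (keyAt-increasing r p<p′ lt′)))
  ... | tri> _ _ p′<p =
    ⊥-elim (≺-irrefl (subst (keyAt xs p′ ≺_) same (keyAt-increasing r p′<p lt)))

  edges-injective : ∀ {k xs z} → Rising k xs z → ∀ {p p′} →
                    suc p < length xs → suc p′ < length xs → xs ‼ p ≡ xs ‼ p′ →
                    xs ‼ suc p ≡ xs ‼ suc p′ → p ≡ p′
  edges-injective r lt lt′ same same′ = keyAt-injective r lt lt′ (cong₂ key same same′)

  endpoint : ∀ {k x xs z} → Rising k (x ∷ xs) z → (x ∷ xs) ‼ length xs ≡ z
  endpoint (end _)      = refl
  endpoint (step _ _ r) = endpoint r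

data Shape : Set where
  stay stepUp stepDown jumpUp jumpDown : Shape

shape : ℕ → ℕ → Shape
shape zero          zero          = stay
shape zero          (suc zero)    = stepUp
shape zero          (suc (suc _)) = jumpUp
shape (suc x)       (suc y)       = shape x y
shape (suc zero)    zero          = stepDown
shape (suc (suc _)) zero          = jumpDown

shape-stay : ∀ x → shape x x ≡ stay
shape-stay zero    = refl
shape-stay (suc x) = shape-stay x

shape-stepUp : ∀ x → shape x (suc x) ≡ stepUp
shape-stepUp zero    = refl
shape-stepUp (suc x) = shape-stepUp x

shape-stepDown : ∀ y → shape (suc y) y ≡ stepDown
shape-stepDown zero    = refl
shape-stepDown (suc y) = shape-stepDown y

shape-jumpUp : ∀ {x y} → suc x < y → shape x y ≡ jumpUp
shape-jumpUp {zero}  {suc (suc _)} _        = refl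
shape-jumpUp {suc x} {suc y}       (s≤s lt) = shape-jumpUp lt
shape-jumpUp {zero}  {suc zero}    (s≤s ())

shape-jumpDown : ∀ {x y} → suc y < x → shape x y ≡ jumpDown
shape-jumpDown {suc (suc _)} {zero}  _        = refl
shape-jumpDown {suc x}       {suc y} (s≤s lt) = shape-jumpDown lt
shape-jumpDown {suc zero}    {zero}  (s≤s ())

Key : Set
Key = ℕ × ℕ

_<ₖ_ : Rel Key 0ℓ
_<ₖ_ = ×-Lex _≡_ _<_ _<_

<ₖ-trans : Transitive _<ₖ_
<ₖ-trans = ×-transitive {_<₂_ = _<_} isEquivalence (resp₂ _<_) <-trans <-trans

<ₖ-irrefl : ∀ {k} → ¬ k <ₖ k
<ₖ-irrefl = ×-irreflexive {_≈₁_ = _≡_} {_<₁_ = _<_} {_≈₂_ = _≡_} <-irrefl <-irrefl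
                          (refl , refl)

rays : ℕ → ℕ → ℕ → List ℕ → List ℕ
rays a c zero    t = t
rays a c (suc n) t = c ∷ a ∷ rays a (suc c) n t

star : ℕ → ℕ → List ℕ → List ℕ
star a n t = a ∷ rays a (2 + a) n t

-- The blocks a, …, a + j − 1, each a loop at its vertex followed by a star with
-- r + 2(j − 1), …, r rays and a step up, continuing a walk that has just reached a.
blocks : ℕ → ℕ → ℕ → List ℕ → List ℕ
blocks r a zero    t = t
blocks r a (suc j) t = star a (r + (j + j)) (suc a ∷ blocks r (suc a) j t)

length-rays : ∀ a c n t → length (rays a c n t) ≡ n + n + length t
length-rays a c zero    t = refl
length-rays a c (suc n) t =
  trans (cong (suc ∘′ suc) (length-rays a (suc c) n t)) (count n (length t))
  where
  count : ∀ n l → suc (suc (n + n + l)) ≡ suc n + suc n + l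
  count = solve-∀

length-blocks : ∀ r a j t → length (blocks r a j t) ≡ j * (r + j) * 2 + length t
length-blocks r a zero    t = refl
length-blocks r a (suc j) t
  rewrite length-rays a (2 + a) (r + (j + j)) (suc a ∷ blocks r (suc a) j t)
        | length-blocks r (suc a) j t = count r j (length t)
  where
  count : ∀ r j l → suc (r + (j + j) + (r + (j + j)) + suc (j * (r + j) * 2 + l))
                    ≡ suc j * (r + suc j) * 2 + l
  count = solve-∀

module Construction (q : ℕ) where

  data Good : ℕ → ℕ → Set where
    inner    : ∀ {x y} → 0 < x → 0 < y → x + y < q → Good x y
    fromZero : ∀ {y} → 0 < y → y + y < q → Good 0 y
    toZero   : ∀ {x} → 0 < x → x + x < q → Good x 0

  Good-sym : ∀ {x y} → Good x y → Good y x
  Good-sym {x} {y} (inner 0<x 0<y x+y<q) = inner 0<y 0<x (subst (_< q) (+-comm x y) x+y<q)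
  Good-sym (fromZero 0<y y+y<q) = toZero 0<y y+y<q
  Good-sym (toZero 0<x x+x<q)   = fromZero 0<x x+x<q

  Good-fst< : ∀ {x y} → Good x y → x < q
  Good-fst< {x} {y} (inner _ _ x+y<q) = ≤-<-trans (m≤m+n x y) x+y<q
  Good-fst< (fromZero _ y+y<q)        = ≤-<-trans z≤n y+y<q
  Good-fst< {x} (toZero _ x+x<q)      = ≤-<-trans (m≤m+n x x) x+x<q

  Good-snd< : ∀ {x y} → Good x y → y < q
  Good-snd< g = Good-fst< (Good-sym g)

  Good-downʳ : ∀ {x y y′} → 0 < y′ → y′ ≤ y → Good x y → Good x y′
  Good-downʳ {x} 0<y′ y′≤y (inner 0<x _ x+y<q) =
    inner 0<x 0<y′ (≤-<-trans (+-monoʳ-≤ x y′≤y) x+y<q)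
  Good-downʳ 0<y′ y′≤y (fromZero _ y+y<q) =
    fromZero 0<y′ (≤-<-trans (+-mono-≤ y′≤y y′≤y) y+y<q)
  Good-downʳ () z≤n (toZero _ _)

  complements-exceed : ∀ u v x y → u + y ≡ q → v + x ≡ q → u + v < q → x + y < q → ⊥
  complements-exceed u v x y u+y≡q v+x≡q u+v<q x+y<q =
    <-irrefl (trans (regroup u v x y) (cong₂ _+_ u+y≡q v+x≡q)) (+-mono-< u+v<q x+y<q)
    where
    regroup : ∀ u v x y → (u + v) + (x + y) ≡ (u + y) + (v + x)
    regroup = solve-∀

  zero-pair-negation-free : ∀ {u y} → 0 < y → y + y < q → u + y ≡ q → ¬ Good u 0
  zero-pair-negation-free _ _ _ (inner _ () _)
  zero-pair-negation-free _ _ _ (fromZero () _)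
  zero-pair-negation-free {u} {y} _ y+y<q u+y≡q (toZero _ u+u<q) =
    complements-exceed u u y y u+y≡q u+y≡q u+u<q y+y<q

  -- (x, y) ↦ (q − y, q − x) turns a sum below q into a sum above q.
  Good-negation-free : ∀ {x y} → Good x y → ¬ Good (negq q y) (negq q x)
  Good-negation-free {x} {y} (inner 0<x 0<y x+y<q) =
    inner-case (negq-complement 0<y y<q) (negq-complement 0<x x<q)
    where
    x<q = ≤-<-trans (m≤m+n x y) x+y<q
    y<q = ≤-<-trans (m≤n+m y x) x+y<q
    inner-case : ∀ {u v} → u + y ≡ q → v + x ≡ q → ¬ Good u v
    inner-case {u} {v} u+y≡q v+x≡q (inner _ _ u+v<q) =
      complements-exceed u v x y u+y≡q v+x≡q u+v<q x+y<q
    inner-case y≡q _ (fromZero _ _) = <-irrefl y≡q y<q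
    inner-case _ x≡q (toZero _ _)   = <-irrefl x≡q x<q
  Good-negation-free g@(fromZero 0<y y+y<q) g′ =
    zero-pair-negation-free 0<y y+y<q (negq-complement 0<y y<q)
      (subst (Good _) (negq-zero 0<q) g′)
    where
    y<q = Good-snd< g
    0<q = ≤-<-trans z≤n y<q
  Good-negation-free g@(toZero 0<x x+x<q) g′ =
    zero-pair-negation-free 0<x x+x<q (negq-complement 0<x x<q)
      (subst (Good _) (negq-zero 0<q) (Good-sym g′))
    where
    x<q = Good-fst< g
    0<q = ≤-<-trans z≤n x<q

  -- Ordered lexicographically, these keys strictly increase along the walks built below.
  edgeKey : ℕ → ℕ → Key
  edgeKey x y with shape x y
  ... | stay     = x , 0
  ... | stepUp   = x , q + q
  ... | jumpUp   = x , y + y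
  ... | jumpDown = y , suc (x + x)
  ... | stepDown = q ∸ y , 0

  key-stay : ∀ x → edgeKey x x ≡ (x , 0)
  key-stay x rewrite shape-stay x = refl

  key-stepUp : ∀ x → edgeKey x (suc x) ≡ (x , q + q)
  key-stepUp x rewrite shape-stepUp x = refl

  key-stepDown : ∀ y → edgeKey (suc y) y ≡ (q ∸ y , 0)
  key-stepDown y rewrite shape-stepDown y = refl

  key-jumpUp : ∀ {x y} → suc x < y → edgeKey x y ≡ (x , y + y)
  key-jumpUp lt rewrite shape-jumpUp lt = refl

  key-jumpDown : ∀ {x y} → suc y < x → edgeKey x y ≡ (y , suc (x + x))
  key-jumpDown lt rewrite shape-jumpDown lt = refl

  open RisingWalks _<ₖ_ <ₖ-trans <ₖ-irrefl Good edgeKey public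

  rays-rising : ∀ {a p m t z} → suc a ≤ p → Good a (p + m) →
                Rising (a , q + q) (suc a ∷ t) z →
                Rising (a , suc (p + p)) (a ∷ rays a (suc p) m (suc a ∷ t)) z
  rays-rising {a} {p} {zero} a<p g rest =
    stepAt (key-stepUp a) (inj₂ (refl , 1+2p<2q))
      (Good-downʳ (s≤s z≤n) (≤-trans a<p p≤p+0) g) rest
    where
    p≤p+0 = m≤m+n p 0
    p<q = ≤-<-trans p≤p+0 (Good-snd< g)
    1+2p<2q = subst (_≤ q + q) (cong suc (+-suc p p)) (+-mono-≤ p<q p<q)
  rays-rising {a} {p} {suc m} a<p g rest =
    stepAt (key-jumpUp (s≤s a<p)) (inj₂ (refl , s≤s (+-monoʳ-< p (n<1+n p)))) ray $
    stepAt (key-jumpDown (s≤s a<p)) (inj₂ (refl , n<1+n _)) (Good-sym ray) $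
    rays-rising (m≤n⇒m≤1+n a<p) g′ rest
    where
    g′ = subst (Good a) (+-suc p m) g
    ray = Good-downʳ (s≤s z≤n) (s≤s (m≤m+n p m)) g′

  star-rising : ∀ {a n t z} → Good a (suc (a + n)) → Rising (a , q + q) (suc a ∷ t) z →
                Rising (a , 0) (star a n (suc a ∷ t)) z
  star-rising g rest = weaken (inj₂ (refl , s≤s z≤n)) (rays-rising ≤-refl g rest)

  blocks-rising : ∀ {r b j t z} → suc (b + b + (r + (j + j))) < q →
                  Rising (b + j , q + q) (suc (b + j) ∷ t) z →
                  Rising (b , q + q) (suc b ∷ blocks r (suc b) j t) z
  blocks-rising {b = b} {zero} {t} {z} _ rest =
    subst (λ c → Rising (c , q + q) (suc c ∷ t) z) (+-identityʳ b) rest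
  blocks-rising {r} {b} {suc j} {t} {z} fits rest =
    stepAt (key-stay (suc b)) (inj₁ (n<1+n b))
      (Good-downʳ (s≤s z≤n) (m≤n⇒m≤1+n (s≤s (m≤m+n b _))) star-fits) $
    star-rising star-fits $
    blocks-rising (subst (_< q) (sym (next-sum b r j)) fits)
                  (subst (λ c → Rising (c , q + q) (suc c ∷ t) z) (+-suc b j) rest)
    where
    star-sum : ∀ b r j → suc b + suc (suc b + (r + (j + j)))
                         ≡ suc (b + b + (r + (suc j + suc j)))
    star-sum = solve-∀
    next-sum : ∀ b r j → suc (suc b + suc b + (r + (j + j)))
                         ≡ suc (b + b + (r + (suc j + suc j)))
    next-sum = solve-∀
    star-fits : Good (suc b) (suc (suc b + (r + (j + j))))
    star-fits = inner (s≤s z≤n) (s≤s z≤n) (subst (_< q) (sym (star-sum b r j)) fits)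

  descent-rising : ∀ {k y} → 2 < q → y + suc y < q → k <ₖ (q ∸ y , 0) →
                   Rising k (downFrom (2 + y)) 0
  descent-rising {y = zero} 2<q _ k< = stepAt (key-stepDown 0) k< (toZero (s≤s z≤n) 2<q) (end 0)
  descent-rising {y = suc y} 2<q fits k< =
    stepAt (key-stepDown (suc y)) k<
      (inner (s≤s z≤n) (s≤s z≤n) (subst (_< q) (+-comm (suc y) _) fits)) $
    descent-rising 2<q (≤-<-trans (+-mono-≤ (n≤1+n y) (n≤1+n (suc y))) fits)
                   (inj₁ (∸-monoʳ-< (n<1+n y) (≤-trans (m≤m+n (suc y) _) (<⇒≤ fits))))

  walk-negOrientable : ∀ {k x xs m} → Rising k (x ∷ xs) x → length xs ≡ suc m →
                       IsNegOrientable q 2 (suc m) (cyclic ((x ∷ xs) ‼_) m)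
  walk-negOrientable {x = x} {xs} {m} walk len =
    cyclic-negOrientable closed Good Good-fst< Good-negation-free
      (λ p≤m → edgeAt walk _ (inside p≤m))
      (λ p≤m p′≤m → edges-injective walk (inside p≤m) (inside p′≤m))
    where
    closed : (x ∷ xs) ‼ suc m ≡ x
    closed = subst (λ n → (x ∷ xs) ‼ n ≡ x) len (endpoint walk)
    inside : ∀ {p} → p ≤ m → suc p < length (x ∷ xs)
    inside p≤m = s≤s (subst (suc _ ≤_) (sym len) (s≤s p≤m))

oddWalk : ℕ → List ℕ
oddWalk k = star 0 k (1 ∷ blocks 1 1 k (downFrom (2 + k)))

evenWalk : ℕ → List ℕ
evenWalk h = star 0 h (1 ∷ blocks 0 1 (suc h) (downFrom (2 + h)))

oddWalk-rising : ∀ k → Construction.Rising (suc (suc k + suc k)) (0 , 0) (oddWalk k) 0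
oddWalk-rising k =
  star-rising (fromZero (s≤s z≤n) ≤-refl) $
  blocks-rising (s≤s (s≤s (≤-reflexive (sym (+-suc k k))))) $
  stepAt (key-stay (suc k)) (inj₁ ≤-refl) (inner (s≤s z≤n) (s≤s z≤n) ≤-refl) $
  descent-rising 2<q (m<n⇒m<1+n (n<1+n _)) (inj₁ top<q∸k)
  where
  open Construction (suc (suc k + suc k))
  2<q : 2 < suc (suc k + suc k)
  2<q = s≤s (s≤s (≤-trans (s≤s z≤n) (m≤n+m (suc k) k)))
  top<q∸k : suc k < suc (suc k + suc k) ∸ k
  top<q∸k = m+n≤o⇒m≤o∸n (suc (suc k)) (s≤s (s≤s (+-monoʳ-≤ k (n≤1+n k))))

evenWalk-rising : ∀ h → Construction.Rising (suc (suc h) + suc (suc h)) (0 , 0) (evenWalk h) 0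
evenWalk-rising h =
  star-rising (fromZero (s≤s z≤n) 2[1+h]<q) $
  blocks-rising (s≤s (s≤s (≤-reflexive (sym (+-suc h (suc h)))))) $
  descent-rising 2<q ≤-refl (inj₁ (m+n≤o⇒m≤o∸n (suc (suc h)) 2[1+h]<q))
  where
  open Construction (suc (suc h) + suc (suc h))
  2<q : 2 < suc (suc h) + suc (suc h)
  2<q = s≤s (s≤s (≤-trans (s≤s z≤n) (m≤n+m _ h)))
  2[1+h]<q : suc h + suc h < suc (suc h) + suc (suc h)
  2[1+h]<q = s≤s (+-monoʳ-≤ (suc h) (n≤1+n (suc h)))

oddWalk-length : ∀ k → length (oddWalk k) ≡ suc (suc k * suc (suc k + suc k))
oddWalk-length k
  rewrite length-rays 0 2 k (1 ∷ blocks 1 1 k (downFrom (2 + k)))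
        | length-blocks 1 1 k (downFrom (2 + k))
        | length-downFrom (2 + k) = count k
  where
  count : ∀ k → suc (k + k + suc (k * (1 + k) * 2 + suc (suc k)))
                ≡ suc (suc k * suc (suc k + suc k))
  count = solve-∀

evenWalk-length : ∀ h → length (evenWalk h) ≡ suc (suc h * suc (suc (suc (suc h + suc h))))
evenWalk-length h
  rewrite length-rays 0 2 h (1 ∷ blocks 0 1 (suc h) (downFrom (2 + h)))
        | length-blocks 0 1 (suc h) (downFrom (2 + h))
        | length-downFrom (2 + h) = count h
  where
  count : ∀ h → suc (h + h + suc (suc h * (0 + suc h) * 2 + suc (suc h)))
                ≡ suc (suc h * suc (suc (suc (suc h + suc h))))
  count = solve-∀

data Parity : ℕ → Set where
  even : ∀ n → Parity (n + n)
  odd  : ∀ n → Parity (suc (n + n))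

parity : ∀ n → Parity n
parity zero = even zero
parity (suc n) with parity n
... | even k = odd k
... | odd k  = subst Parity (cong suc (+-suc k k)) (even (suc k))

q*q≡q+n*2⇒[q*q∸q]/2≡n : ∀ q n → q * q ≡ q + n * 2 → (q * q ∸ q) / 2 ≡ n
q*q≡q+n*2⇒[q*q∸q]/2≡n q n square = begin
  (q * q ∸ q) / 2     ≡⟨ cong (λ t → (t ∸ q) / 2) square ⟩
  (q + n * 2 ∸ q) / 2 ≡⟨ cong (_/ 2) (m+n∸m≡n q (n * 2)) ⟩
  n * 2 / 2           ≡⟨ m*n/n≡m n 2 ⟩
  n                   ∎
  where open ≡-Reasoning

[n+n]%2≡0 : ∀ n → (n + n) % 2 ≡ 0
[n+n]%2≡0 n = trans (cong (_% 2) (double n)) ([m+kn]%n≡m%n 0 n 2)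
  where
  double : ∀ n → n + n ≡ 0 + n * 2
  double = solve-∀

[1+n+n]%2≡1 : ∀ n → suc (n + n) % 2 ≡ 1
[1+n+n]%2≡1 n = trans (cong (_% 2) (double n)) ([m+kn]%n≡m%n 1 n 2)
  where
  double : ∀ n → suc (n + n) ≡ 1 + n * 2
  double = solve-∀

maxPeriod-odd : ∀ n → maxPeriod (suc (n + n)) ≡ n * suc (n + n)
maxPeriod-odd n rewrite [1+n+n]%2≡1 n = q*q≡q+n*2⇒[q*q∸q]/2≡n (suc (n + n)) _ (square n)
  where
  square : ∀ n → suc (n + n) * suc (n + n) ≡ suc (n + n) + n * suc (n + n) * 2
  square = solve-∀

maxPeriod-even : ∀ n → maxPeriod (suc n + suc n) ≡ n * suc (suc (suc (n + n)))
maxPeriod-even n rewrite [n+n]%2≡0 (suc n) =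
  cong (_∸ 1) (q*q≡q+n*2⇒[q*q∸q]/2≡n (suc n + suc n) _ (square n))
  where
  square : ∀ n → (suc n + suc n) * (suc n + suc n)
                 ≡ (suc n + suc n) + suc (n * suc (suc (suc (n + n)))) * 2
  square = solve-∀

lemma5 : (q : ℕ) → 3 ≤ q →
    Σ (ℕ → ℕ) (λ s → IsNegOrientable q 2 (maxPeriod q) s)
lemma5 q 3≤q with parity q
lemma5 _ (s≤s ()) | odd zero
lemma5 _ _ | odd (suc k) rewrite maxPeriod-odd (suc k) =
  _ , Construction.walk-negOrientable _ (oddWalk-rising k) (suc-injective (oddWalk-length k))
lemma5 _ () | even zero
lemma5 _ (s≤s (s≤s ())) | even (suc zero)
lemma5 _ _ | even (suc (suc h)) rewrite maxPeriod-even (suc h) =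
  _ , Construction.walk-negOrientable _ (evenWalk-rising h) (suc-injective (evenWalk-length h))
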